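{- Let $k\in\omega\setminus\{0,1\}$ and let $\varphi:\omega\to\omega$ be a nondecreasing function such that $\varphi(n)\ge n$ for all $n\in\omega$ and $\varphi(0)=0$. Then there exist a nontrivial closed class $A$ of decision tables from $\mathcal{M}_k^{\infty}$ and a bounded complexity measure $\psi$ such that the function $\mathcal{H}^{\infty}_{\psi,A}$ is everywhere defined and $\varphi(n)\le\mathcal{H}^{\infty}_{\psi,A}(n)\le\varphi(n)+n$ for all $n\in\omega$.
   Context: Let $\omega=\{0,1,2,\ldots\}$, let $\mathcal{P}(\omega)$ be the set of nonempty finite subsets of $\omega$, and for $k\in\omega\setminus\{0,1\}$ let $E_k=\{0,\ldots,k-1\}$. Let $P=\{f_i:i\in\omega\}$ be a set of attributes ($f_i\neq f_j$ iff $i\neq j$). $\mathcal{M}_k^{\infty}$ is the set of rectangular tables filled with numbers from $E_k$ whose rows are pairwise different, each row labeled with a set from $\mathcal{P}(\omega)$ (its set of decisions), and whose columns are labeled with pairwise different attributes from $P$; tables with no rows, all denoted $\Lambda$, also belong to $\mathcal{M}_k^{\infty}$. For $T\in\mathcal{M}_k^\infty$: $\Delta(T)$ is its set of rows, $\operatorname{At}(T)$ its set of column attributes, $\Pi(T)$ the intersection of the decision sets of all its rows (common decisions). For nonempty $T$, for a word $\alpha=(f_{i_1},\delta_1)\cdots(f_{i_m},\delta_m)$ with $f_{i_j}\in\operatorname{At}(T)$, $\delta_j\in E_k$, $T\alpha$ is the subtable of rows having $\delta_1,\ldots,\delta_m$ in the columns labeled $f_{i_1},\ldots,f_{i_m}$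 respectively ($T\lambda=T$ for the empty word $\lambda$). Operations: for $D\subseteq\operatorname{At}(T)$, $I(D,T)$ is obtained by deleting the columns labeled by attributes in $D$ and, in each group of rows equal on the remaining columns, keeping only the first one (with its decision set); for $\nu:E_k^{|\operatorname{At}(T)|}\to\mathcal{P}(\omega)$, $J(\nu,T)$ replaces the decision set of each row $\bar\delta$ by $\nu(\bar\delta)$. $[T]=\{J(\nu,I(D,T)):D\subseteq\operatorname{At}(T),\nu:E_k^{|\operatorname{At}(T)\setminus D|}\to\mathcal{P}(\omega)\}$, $[A]=\bigcup_{T\in A}[T]$; $A$ is a closed class if $[A]=A$, nontrivial if it contains a nonempty table. Decision trees: a $k$-decision tree is a finite directed rooted tree with at least two nodes, where the root and edges leaving it are unlabeled, terminal nodes are labeled with decisions from $\omega$, and every other node is labeled with an attribute from $P$, each edge leaving it labeled with a number from $E_k$. $\operatorname{At}(\Gamma)$ is the set of attributes labeling its nodes. For a complete path $\tau=v_1,d_1,\ldots,v_m,d_m,v_{m+1}$ (root to a terminal node), $\pi(\tau)=\lambda$ if $m=1$, otherwise $\pi(\tau)=(f_{i_2},\delta_2)\cdots(f_{i_m},\delta_m)$ where $v_j$ is labeled $f_{i_j}$ and $d_j$ is labeled $\delta_j$; $T(\tau)=T\pi(\tau)$. For nonempty $T$, a nondeterministic decision tree for $T$ is a $k$-decision tree $\Gamma$ with $\operatorname{At}(\Gamma)\subseteq\operatorname{At}(T)$ such that each row of $T$ belongs to $T(\tau)$ for some complete path $\tau$, and for each complete path $\tau$ either $T(\tau)=\Lambda$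 or the decision at its terminal node lies in $\Pi(T(\tau))$. A deterministic decision tree for $T$ is a nondeterministic one in which exactly one edge leaves the root and edges leaving any other nonterminal node have pairwise different labels. Complexity measures: $P^*$ is the set of finite words over $P$ (including $\lambda$). A partially bounded complexity measure is $\psi:P^*\to\omega$ with: $\psi(\alpha)=0$ iff $\alpha=\lambda$; $\psi$ invariant under permutation of letters; $\psi(\alpha_1)\le\psi(\alpha_1\alpha_2)$; $\psi(\alpha_1\alpha_2)\le\psi(\alpha_1)+\psi(\alpha_2)$. It is bounded if also $\psi(\alpha)\ge|\alpha|$ for all $\alpha$. Extend $\psi$ to words over pairs by $\psi((f_{i_1},\delta_1)\cdots(f_{i_m},\delta_m))=\psi(f_{i_1}\cdots f_{i_m})$, $\psi(\lambda)=0$, and to trees by $\psi(\Gamma)=\max_\tau\psi(\pi(\tau))$ over complete paths. For nonempty $T$, $\psi^d(T)$ ($\psi^a(T)$) is the minimum of $\psi(\Gamma)$ over deterministic (nondeterministic) decision trees for $T$; $\psi^d(\Lambda)=\psi^a(\Lambda)=0$. $\mathcal{H}^{\infty}_{\psi,A}(n)$ is undefined if $\{\psi^d(T):T\in A,\psi^a(T)\le n\}$ is infinite and equals its maximum otherwise. -}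

module Defs where

open import Data.Nat using (ℕ; zero; suc; _+_; _≤_; _⊔_; _≡ᵇ_)
open import Data.Fin using (Fin) renaming (_≟_ to _≟ᶠ_)
open import Data.Bool using (Bool; true; false; _∧_; if_then_else_)
open import Data.Maybe using (Maybe; just; nothing)
open import Data.List using (List; []; _∷_; _++_; map; length; foldr; concatMap; deduplicateᵇ)
open import Data.List.Properties using (≡-dec)
open import Data.List.Relation.Unary.All using (All)
open import Data.List.Relation.Unary.Unique.Propositional using (Unique)
open import Data.List.Membership.Propositional using (_∈_)
open import Data.List.Relation.Binary.Permutation.Propositional using (_↭_)
open import Data.Product using (Σ; ∃; _×_; _,_; proj₁; proj₂)
open import Data.Sum using (_⊎_)
open import Relation.Nullary using (¬_)
open import Relation.Nullary.Decidable using (⌊_⌋)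
open import Relation.Binary.PropositionalEquality using (_≡_; _≢_)

-- Decision tables from M_k^∞
-- The attribute f_i is represented by its index i : ℕ.
-- A decision set (nonempty finite subset of ω) is represented by a
-- nonempty list of naturals (only membership is ever used).

DecSet : Set
DecSet = List ℕ

Row : ℕ → Set
Row k = List (Fin k) × DecSet

record Table (k : ℕ) : Set where
  constructor mkTable
  field
    attrs : List ℕ
    rows  : List (Row k)
open Table public

WFTable : {k : ℕ} → Table k → Set
WFTable T =
  Unique (attrs T)
  × All (λ r → (length (proj₁ r) ≡ length (attrs T)) × (proj₂ r ≢ [])) (rows T)
  × Unique (map proj₁ (rows T))

-- D ⊆ At(T) given as a mask over the columns: true = delete the column
keepCols : {A : Set} → List Bool → List A → List A
keepCols (true  ∷ m) (x ∷ xs) = keepCols m xs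
keepCols (false ∷ m) (x ∷ xs) = x ∷ keepCols m xs
keepCols _ _ = []

eqVals : {k : ℕ} → List (Fin k) → List (Fin k) → Bool
eqVals xs ys = ⌊ ≡-dec _≟ᶠ_ xs ys ⌋

Iop : {k : ℕ} → List Bool → Table k → Table k
Iop D T = mkTable (keepCols D (attrs T))
  (deduplicateᵇ (λ r s → eqVals (proj₁ r) (proj₁ s))
     (map (λ r → keepCols D (proj₁ r) , proj₂ r) (rows T)))

Jop : {k : ℕ} → (List (Fin k) → DecSet) → Table k → Table k
Jop ν T = mkTable (attrs T) (map (λ r → proj₁ r , ν (proj₁ r)) (rows T))

InClosure : {k : ℕ} → Table k → Table k → Set
InClosure {k} T T' =
  Σ (List Bool) λ D → Σ (List (Fin k) → DecSet) λ ν →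
    (length D ≡ length (attrs T)) × (∀ v → ν v ≢ []) × (T' ≡ Jop ν (Iop D T))

ClosedClass : (k : ℕ) → (Table k → Set) → Set
ClosedClass k A =
  (∀ T → A T → WFTable T)
  × (∀ T T' → A T → InClosure T T' → A T')
  × (∀ T' → A T' → Σ (Table k) λ T → A T × InClosure T T')

Nontrivial : {k : ℕ} → (Table k → Set) → Set
Nontrivial {k} A = Σ (Table k) λ T → A T × (rows T ≢ [])

Word : ℕ → Set
Word k = List (ℕ × Fin k)

valAt : {k : ℕ} → List ℕ → List (Fin k) → ℕ → Maybe (Fin k)
valAt (a ∷ as) (v ∷ vs) f = if a ≡ᵇ f then just v else valAt as vs f
valAt _ _ _ = nothing

eqAt : {k : ℕ} → Maybe (Fin k) → Fin k → Bool
eqAt (just v) δ = ⌊ v ≟ᶠ δ ⌋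
eqAt nothing δ = false

satisfies : {k : ℕ} → List ℕ → List (Fin k) → Word k → Bool
satisfies as vs [] = true
satisfies as vs ((f , δ) ∷ w) = eqAt (valAt as vs f) δ ∧ satisfies as vs w

filterᵇ : {A : Set} → (A → Bool) → List A → List A
filterᵇ p [] = []
filterᵇ p (x ∷ xs) = if p x then x ∷ filterᵇ p xs else filterᵇ p xs

sub : {k : ℕ} → Table k → Word k → Table k
sub T α = mkTable (attrs T) (filterᵇ (λ r → satisfies (attrs T) (proj₁ r) α) (rows T))

InΠ : {k : ℕ} → Table k → ℕ → Set
InΠ T d = All (λ r → d ∈ proj₂ r) (rows T)

-- A tree is the list
-- of children of the (unlabelled) root.

data Node (k : ℕ) : Set where
  leaf : ℕ → Node k
  test : ℕ → List (Fin k × Node k) → Node k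

Tree : ℕ → Set
Tree k = List (Node k)

data WFNode {k : ℕ} : Node k → Set where
  leafWF : ∀ d → WFNode (leaf d)
  testWF : ∀ f cs → cs ≢ [] → All (λ c → WFNode (proj₂ c)) cs → WFNode (test f cs)

-- at least two nodes: the root has a child
WFTree : {k : ℕ} → Tree k → Set
WFTree Γ = (Γ ≢ []) × All WFNode Γ

data AttrNode {k : ℕ} (P : ℕ → Set) : Node k → Set where
  leafA : ∀ d → AttrNode P (leaf d)
  testA : ∀ f cs → P f → All (λ c → AttrNode P (proj₂ c)) cs → AttrNode P (test f cs)

data DetNode {k : ℕ} : Node k → Set where
  leafD : ∀ d → DetNode (leaf d)
  testD : ∀ f cs → Unique (map proj₁ cs) → All (λ c → DetNode (proj₂ c)) cs → DetNode (test f cs)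

DetTree : {k : ℕ} → Tree k → Set
DetTree Γ = (length Γ ≡ 1) × All DetNode Γ

mutual
  pathsN : {k : ℕ} → Node k → List (Word k × ℕ)
  pathsN (leaf d) = (([] , d) ∷ [])
  pathsN (test f cs) = pathsCs f cs

  pathsCs : {k : ℕ} → ℕ → List (Fin k × Node k) → List (Word k × ℕ)
  pathsCs f [] = []
  pathsCs f ((δ , c) ∷ cs) = map (λ p → ((f , δ) ∷ proj₁ p) , proj₂ p) (pathsN c) ++ pathsCs f cs

paths : {k : ℕ} → Tree k → List (Word k × ℕ)
paths Γ = concatMap pathsN Γ

record IsNDTree {k : ℕ} (T : Table k) (Γ : Tree k) : Set where
  field
    wf      : WFTree Γ
    attrsOK : All (AttrNode (λ f → f ∈ attrs T)) Γ
    covers  : ∀ r → r ∈ rows T → Σ (Word k × ℕ) λ p → (p ∈ paths Γ) × (r ∈ rows (sub T (proj₁ p)))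
    correct : ∀ p → p ∈ paths Γ → (rows (sub T (proj₁ p)) ≡ []) ⊎ InΠ (sub T (proj₁ p)) (proj₂ p)

IsDTree : {k : ℕ} → Table k → Tree k → Set
IsDTree T Γ = IsNDTree T Γ × DetTree Γ

-- Complexity measures (words over P are lists of attribute indices)

record PartiallyBoundedMeasure (ψ : List ℕ → ℕ) : Set where
  field
    zero⇒nil : ∀ α → ψ α ≡ 0 → α ≡ []
    nil⇒zero : ψ [] ≡ 0
    perm     : ∀ α β → α ↭ β → ψ α ≡ ψ β
    mono     : ∀ α β → ψ α ≤ ψ (α ++ β)
    subadd   : ∀ α β → ψ (α ++ β) ≤ ψ α + ψ β

record BoundedMeasure (ψ : List ℕ → ℕ) : Set where
  field
    partial : PartiallyBoundedMeasure ψ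
    bounded : ∀ α → length α ≤ ψ α

ψword : {k : ℕ} → (List ℕ → ℕ) → Word k → ℕ
ψword ψ w = ψ (map proj₁ w)

ψtree : {k : ℕ} → (List ℕ → ℕ) → Tree k → ℕ
ψtree ψ Γ = foldr _⊔_ 0 (map (λ p → ψword ψ (proj₁ p)) (paths Γ))

IsPsiD : {k : ℕ} → (List ℕ → ℕ) → Table k → ℕ → Set
IsPsiD {k} ψ T n =
  (rows T ≡ [] → n ≡ 0)
  × (rows T ≢ [] →
       (Σ (Tree k) λ Γ → IsDTree T Γ × (ψtree ψ Γ ≡ n))
       × (∀ Γ → IsDTree T Γ → n ≤ ψtree ψ Γ))

IsPsiA : {k : ℕ} → (List ℕ → ℕ) → Table k → ℕ → Set
IsPsiA {k} ψ T n =
  (rows T ≡ [] → n ≡ 0)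
  × (rows T ≢ [] →
       (Σ (Tree k) λ Γ → IsNDTree T Γ × (ψtree ψ Γ ≡ n))
       × (∀ Γ → IsNDTree T Γ → n ≤ ψtree ψ Γ))

HIs : {k : ℕ} → (List ℕ → ℕ) → (Table k → Set) → ℕ → ℕ → Set
HIs {k} ψ A n h =
  (Σ (Table k) λ T → A T × Σ ℕ λ a → IsPsiA ψ T a × (a ≤ n) × IsPsiD ψ T h)
  × (∀ T a d → A T → IsPsiA ψ T a → a ≤ n → IsPsiD ψ T d → d ≤ h)

-- Give the attribute f_a the weight w(a), the first Cantor coordinate of a, and let
-- ψ(α) = max(|α|, weights in α); this is a bounded complexity measure.  A table has level n
-- if it has at most φ(n) + 1 attributes, all of weight n, every row is a zero or unit vector,
-- and φ(n) + 1 columns occur only when no row is zero; the class A of all such tables is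
-- closed.  A table of level m is solved deterministically at cost ≤ φ(m) by querying its
-- attributes (all but the first, in the unit case) until a 1 appears.  If ψᵃ(T) ≤ n < m, a
-- cheapest nondeterministic tree can query no attribute, so T has a common decision and
-- ψᵈ(T) = 0; by monotonicity H(n) ≤ φ(n).  Conversely the (φ(n) + 1)-dimensional identity table
-- of level n with distinct decisions has ψᵃ = n (ask "is f equal to 1?" for each f) and
-- ψᵈ = φ(n), since an adversary answering 0 eliminates at most one row per query.  So H = φ.

module Submission where

open import Defs
open import Data.Nat using (ℕ; zero; suc; _+_; _≤_; _<_; _⊔_; _≡ᵇ_; z≤n; s≤s; _≤?_)
open import Data.Nat.Properties
open import Data.Fin using (Fin; zero; suc; toℕ) renaming (_≟_ to _≟ᶠ_)
open import Data.Fin.Properties using (toℕ-injective)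
open import Data.Bool using (Bool; true; false; _∧_; not; T; if_then_else_)
open import Data.Bool.Properties using (∧-assoc; T?; not-involutive)
open import Data.Maybe using (Maybe; just; nothing)
open import Data.Maybe.Properties using (just-injective)
open import Data.List using (List; []; _∷_; _++_; map; length; foldr; tabulate; replicate; drop;
  filter; deduplicateᵇ)
open import Data.List.Properties
  using (length-++; length-map; length-tabulate; length-replicate;
         map-tabulate; ≡-dec; filter-all; map-id-local)
open import Data.List.Relation.Unary.All as All using (All; []; _∷_)
open import Data.List.Relation.Unary.All.Properties using ()
  renaming (map⁺ to All-map⁺; tabulate⁺ to All-tabulate⁺; tabulate⁻ to All-tabulate⁻)
open import Data.List.Relation.Unary.AllPairs using ([]; _∷_)
import Data.List.Relation.Unary.AllPairs.Properties as AllPairs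
open import Data.List.Relation.Unary.Any using (here; there)
open import Data.List.Relation.Unary.Unique.Propositional using (Unique)
open import Data.List.Relation.Unary.Unique.Propositional.Properties using ()
  renaming (tabulate⁺ to Unique-tabulate⁺)
open import Data.List.Membership.Propositional using (_∈_)
open import Data.List.Membership.Propositional.Properties
  using (∈-map⁺; ∈-map⁻; ∈-++⁻; ∈-++⁺ˡ; ∈-++⁺ʳ; ∈-tabulate⁻; ∈-filter⁻; ∈-deduplicate⁻)
open import Data.List.Relation.Binary.Permutation.Propositional as ↭ using (_↭_)
open import Data.List.Relation.Binary.Permutation.Propositional.Properties using (↭-length)
open import Data.Product using (Σ; ∃; _×_; _,_; proj₁; proj₂)
open import Data.Sum using (_⊎_; inj₁; inj₂)
open import Data.Empty using (⊥-elim)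
open import Data.Unit using (tt)
open import Function using (_∘_; _∘₂_)
open import Relation.Nullary using (¬_; Dec; yes; no; ¬?)
open import Relation.Binary.PropositionalEquality
  using (_≡_; _≢_; refl; sym; trans; cong; cong₂; subst; module ≡-Reasoning)

private
  next : ℕ × ℕ → ℕ × ℕ
  next (zero , b) = (suc b , zero)
  next (suc a , b) = (a , suc b)

unpair : ℕ → ℕ × ℕ
unpair zero = (0 , 0)
unpair (suc x) = next (unpair x)

unpair-surjective : ∀ a b → ∃ λ x → unpair x ≡ (a , b)
unpair-surjective a b = onDiagonal (a + b) a b refl
  where
  onDiagonal : ∀ d a b → a + b ≡ d → ∃ λ x → unpair x ≡ (a , b)
  onDiagonal d a (suc b) e with onDiagonal d (suc a) b (trans (sym (+-suc a b)) e)
  ... | x , eq = suc x , cong next eq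
  onDiagonal zero zero zero e = 0 , refl
  onDiagonal (suc d) (suc a) zero e with onDiagonal d zero a (trans (sym (+-identityʳ a)) (suc-injective e))
  ... | x , eq = suc x , cong next eq

pair : ℕ → ℕ → ℕ
pair a b = proj₁ (unpair-surjective a b)

unpair-pair : ∀ a b → unpair (pair a b) ≡ (a , b)
unpair-pair a b = proj₂ (unpair-surjective a b)

weight : ℕ → ℕ
weight = proj₁ ∘ unpair

weight-pair : ∀ a b → weight (pair a b) ≡ a
weight-pair a b = cong proj₁ (unpair-pair a b)

pair-injectiveʳ : ∀ a {b c} → pair a b ≡ pair a c → b ≡ c
pair-injectiveʳ a {b} {c} e =
  cong proj₂ (trans (sym (unpair-pair a b)) (trans (cong unpair e) (unpair-pair a c)))

maxWeight : List ℕ → ℕ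
maxWeight = foldr (λ x m → weight x ⊔ m) 0

maxWeight-++ : ∀ α β → maxWeight (α ++ β) ≡ maxWeight α ⊔ maxWeight β
maxWeight-++ [] β = refl
maxWeight-++ (x ∷ α) β =
  trans (cong (weight x ⊔_) (maxWeight-++ α β)) (sym (⊔-assoc (weight x) (maxWeight α) (maxWeight β)))

maxWeight-↭ : ∀ {α β} → α ↭ β → maxWeight α ≡ maxWeight β
maxWeight-↭ ↭.refl = refl
maxWeight-↭ (↭.prep x p) = cong (weight x ⊔_) (maxWeight-↭ p)
maxWeight-↭ {x ∷ y ∷ xs} {.y ∷ .x ∷ ys} (↭.swap .x .y p) = begin
  weight x ⊔ (weight y ⊔ maxWeight xs)  ≡⟨ ⊔-assoc (weight x) (weight y) (maxWeight xs) ⟨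
  (weight x ⊔ weight y) ⊔ maxWeight xs  ≡⟨ cong₂ _⊔_ (⊔-comm (weight x) (weight y)) (maxWeight-↭ p) ⟩
  (weight y ⊔ weight x) ⊔ maxWeight ys  ≡⟨ ⊔-assoc (weight y) (weight x) (maxWeight ys) ⟩
  weight y ⊔ (weight x ⊔ maxWeight ys)  ∎
  where open ≡-Reasoning
maxWeight-↭ (↭.trans p q) = trans (maxWeight-↭ p) (maxWeight-↭ q)

weight≤maxWeight : ∀ {a α} → a ∈ α → weight a ≤ maxWeight α
weight≤maxWeight {a} (here refl) = m≤m⊔n (weight a) _
weight≤maxWeight {α = b ∷ α} (there m) = ≤-trans (weight≤maxWeight m) (m≤n⊔m (weight b) _)

maxWeight≤ : ∀ {α B} → All (λ a → weight a ≤ B) α → maxWeight α ≤ B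
maxWeight≤ [] = z≤n
maxWeight≤ (h ∷ hs) = ⊔-lub h (maxWeight≤ hs)

ψ : List ℕ → ℕ
ψ α = length α ⊔ maxWeight α

ψ-bounded : BoundedMeasure ψ
ψ-bounded = record
  { partial = record
    { zero⇒nil = zero⇒nil
    ; nil⇒zero = refl
    ; perm = λ α β p → cong₂ _⊔_ (↭-length p) (maxWeight-↭ p)
    ; mono = mono
    ; subadd = subadd }
  ; bounded = λ α → m≤m⊔n (length α) (maxWeight α) }
  where
  zero⇒nil : ∀ α → ψ α ≡ 0 → α ≡ []
  zero⇒nil [] _ = refl
  zero⇒nil (x ∷ α) e with subst (length (x ∷ α) ≤_) e (m≤m⊔n (length (x ∷ α)) (maxWeight (x ∷ α)))
  ... | ()
  mono : ∀ α β → ψ α ≤ ψ (α ++ β)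
  mono α β rewrite length-++ α {β} | maxWeight-++ α β =
    ⊔-mono-≤ (m≤m+n (length α) (length β)) (m≤m⊔n (maxWeight α) (maxWeight β))
  subadd : ∀ α β → ψ (α ++ β) ≤ ψ α + ψ β
  subadd α β rewrite length-++ α {β} | maxWeight-++ α β =
    ⊔-lub (+-mono-≤ (m≤m⊔n (length α) (maxWeight α)) (m≤m⊔n (length β) (maxWeight β)))
      (⊔-lub (≤-trans (m≤n⊔m (length α) (maxWeight α)) (m≤m+n (ψ α) (ψ β)))
             (≤-trans (m≤n⊔m (length β) (maxWeight β)) (m≤n+m (ψ β) (ψ α))))

module _ {A : Set} where

  ∈-filterᵇ⁻ : ∀ (p : A → Bool) {xs x} → x ∈ filterᵇ p xs → x ∈ xs × p x ≡ true
  ∈-filterᵇ⁻ p {y ∷ xs} m with p y in eq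
  ∈-filterᵇ⁻ p {y ∷ xs} (here refl) | true = here refl , eq
  ∈-filterᵇ⁻ p {y ∷ xs} (there m)   | true = let a , b = ∈-filterᵇ⁻ p m in there a , b
  ∈-filterᵇ⁻ p {y ∷ xs} m           | false = let a , b = ∈-filterᵇ⁻ p m in there a , b

  ∈-filterᵇ⁺ : ∀ (p : A → Bool) {xs x} → x ∈ xs → p x ≡ true → x ∈ filterᵇ p xs
  ∈-filterᵇ⁺ p {y ∷ xs} (here refl) e rewrite e = here refl
  ∈-filterᵇ⁺ p {y ∷ xs} (there m) e with p y
  ... | true = there (∈-filterᵇ⁺ p m e)
  ... | false = ∈-filterᵇ⁺ p m e

  filterᵇ-true : ∀ (xs : List A) → filterᵇ (λ _ → true) xs ≡ xs
  filterᵇ-true [] = refl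
  filterᵇ-true (x ∷ xs) = cong (x ∷_) (filterᵇ-true xs)

  filterᵇ-filterᵇ : ∀ (p q : A → Bool) xs → filterᵇ q (filterᵇ p xs) ≡ filterᵇ (λ x → p x ∧ q x) xs
  filterᵇ-filterᵇ p q [] = refl
  filterᵇ-filterᵇ p q (x ∷ xs) with p x
  ... | false = filterᵇ-filterᵇ p q xs
  ... | true with q x
  ...   | true = cong (x ∷_) (filterᵇ-filterᵇ p q xs)
  ...   | false = filterᵇ-filterᵇ p q xs

  filterᵇ-cong : ∀ {p q : A → Bool} → (∀ x → p x ≡ q x) → ∀ xs → filterᵇ p xs ≡ filterᵇ q xs
  filterᵇ-cong h [] = refl
  filterᵇ-cong {p} {q} h (x ∷ xs) rewrite h x with q x
  ... | true = cong (x ∷_) (filterᵇ-cong h xs)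
  ... | false = filterᵇ-cong h xs

  length-filterᵇ-partition : ∀ (p : A → Bool) xs →
    length xs ≡ length (filterᵇ p xs) + length (filterᵇ (not ∘ p) xs)
  length-filterᵇ-partition p [] = refl
  length-filterᵇ-partition p (x ∷ xs) with p x
  ... | true = cong suc (length-filterᵇ-partition p xs)
  ... | false = trans (cong suc (length-filterᵇ-partition p xs)) (sym (+-suc _ _))

  All-filterᵇ : ∀ {P : A → Set} (p : A → Bool) {xs} → All P xs → All P (filterᵇ p xs)
  All-filterᵇ p ps = All.tabulate λ m → All.lookup ps (proj₁ (∈-filterᵇ⁻ p m))

  ∃-∈-nonempty : ∀ {xs : List A} → xs ≢ [] → ∃ λ x → x ∈ xs
  ∃-∈-nonempty {[]} ne = ⊥-elim (ne refl)
  ∃-∈-nonempty {x ∷ xs} ne = x , here refl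

  ≢[]-∈ : ∀ {x : A} {xs} → x ∈ xs → xs ≢ []
  ≢[]-∈ (here _) ()
  ≢[]-∈ (there _) ()

  empty-or-∈ : ∀ (xs : List A) → xs ≡ [] ⊎ ∃ λ x → x ∈ xs
  empty-or-∈ [] = inj₁ refl
  empty-or-∈ (x ∷ xs) = inj₂ (x , here refl)

  module _ {B : Set} (g : A → B) where

    Unique-map-filterᵇ : ∀ (p : A → Bool) {xs} → Unique (map g xs) → Unique (map g (filterᵇ p xs))
    Unique-map-filterᵇ p {[]} u = u
    Unique-map-filterᵇ p {x ∷ xs} (gx∉ ∷ u) with p x
    ... | false = Unique-map-filterᵇ p u
    ... | true = All.tabulate (λ m → let y , ym , e = ∈-map⁻ g m in
                   subst (g x ≢_) (sym e) (All.lookup gx∉ (∈-map⁺ g (proj₁ (∈-filterᵇ⁻ p ym)))))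
                 ∷ Unique-map-filterᵇ p u

    Unique-map-injective : ∀ {xs x y} → Unique (map g xs) → x ∈ xs → y ∈ xs → g x ≡ g y → x ≡ y
    Unique-map-injective u (here refl) (here refl) e = refl
    Unique-map-injective (gx∉ ∷ u) (here refl) (there m) e = ⊥-elim (All.lookup gx∉ (∈-map⁺ g m) e)
    Unique-map-injective (gx∉ ∷ u) (there m) (here refl) e = ⊥-elim (All.lookup gx∉ (∈-map⁺ g m) (sym e))
    Unique-map-injective (gx∉ ∷ u) (there m) (there m') e = Unique-map-injective u m m' e

    length≤1-if-image-constant : ∀ {xs} → Unique (map g xs) →
      (∀ {x y} → x ∈ xs → y ∈ xs → g x ≡ g y) → length xs ≤ 1
    length≤1-if-image-constant {[]} u h = z≤n
    length≤1-if-image-constant {x ∷ []} u h = ≤-refl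
    length≤1-if-image-constant {x ∷ y ∷ xs} (gx∉ ∷ u) h =
      ⊥-elim (All.lookup gx∉ (here refl) (h (here refl) (there (here refl))))

  All-keepCols : ∀ {P : A → Set} D {xs} → All P xs → All P (keepCols D xs)
  All-keepCols (true ∷ D) (p ∷ ps) = All-keepCols D ps
  All-keepCols (false ∷ D) (p ∷ ps) = p ∷ All-keepCols D ps
  All-keepCols [] ps = []
  All-keepCols (true ∷ D) [] = []
  All-keepCols (false ∷ D) [] = []

  Unique-keepCols : ∀ D {xs : List A} → Unique xs → Unique (keepCols D xs)
  Unique-keepCols (true ∷ D) (p ∷ u) = Unique-keepCols D u
  Unique-keepCols (false ∷ D) (p ∷ u) = All-keepCols D p ∷ Unique-keepCols D u
  Unique-keepCols [] u = []
  Unique-keepCols (true ∷ D) [] = []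
  Unique-keepCols (false ∷ D) [] = []

  length-keepCols≤ : ∀ D (xs : List A) → length (keepCols D xs) ≤ length xs
  length-keepCols≤ (true ∷ D) (x ∷ xs) = m≤n⇒m≤1+n (length-keepCols≤ D xs)
  length-keepCols≤ (false ∷ D) (x ∷ xs) = s≤s (length-keepCols≤ D xs)
  length-keepCols≤ [] xs = z≤n
  length-keepCols≤ (true ∷ D) [] = z≤n
  length-keepCols≤ (false ∷ D) [] = z≤n

  length-keepCols< : ∀ D (xs : List A) → length D ≡ length xs → true ∈ D → length (keepCols D xs) < length xs
  length-keepCols< (true ∷ D) (x ∷ xs) l m = s≤s (length-keepCols≤ D xs)
  length-keepCols< (false ∷ D) (x ∷ xs) l (there m) = s≤s (length-keepCols< D xs (suc-injective l) m)

  keepCols-none : ∀ D (xs : List A) → length D ≡ length xs → All (_≡ false) D → keepCols D xs ≡ xs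
  keepCols-none [] [] l a = refl
  keepCols-none (false ∷ D) (x ∷ xs) l (refl ∷ a) = cong (x ∷_) (keepCols-none D xs (suc-injective l) a)

  length-keepCols : ∀ {B : Set} D (xs : List A) (ys : List B) → length xs ≡ length ys →
    length (keepCols D xs) ≡ length (keepCols D ys)
  length-keepCols (true ∷ D) (x ∷ xs) (y ∷ ys) l = length-keepCols D xs ys (suc-injective l)
  length-keepCols (false ∷ D) (x ∷ xs) (y ∷ ys) l = cong suc (length-keepCols D xs ys (suc-injective l))
  length-keepCols [] xs ys l = refl
  length-keepCols (true ∷ D) [] [] l = refl
  length-keepCols (false ∷ D) [] [] l = refl

deletes-some-or-none : (D : List Bool) → true ∈ D ⊎ All (_≡ false) D
deletes-some-or-none [] = inj₂ []
deletes-some-or-none (true ∷ D) = inj₁ (here refl)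
deletes-some-or-none (false ∷ D) with deletes-some-or-none D
... | inj₁ m = inj₁ (there m)
... | inj₂ a = inj₂ (refl ∷ a)

∧-true : ∀ {a b} → (a ∧ b) ≡ true → a ≡ true × b ≡ true
∧-true {true} {true} _ = refl , refl

≡ᵇ-refl : ∀ n → (n ≡ᵇ n) ≡ true
≡ᵇ-refl zero = refl
≡ᵇ-refl (suc n) = ≡ᵇ-refl n

module _ {k : ℕ} where

  valAt-hit : ∀ a as (v : Fin k) vs → valAt (a ∷ as) (v ∷ vs) a ≡ just v
  valAt-hit a as v vs rewrite ≡ᵇ-refl a = refl

  valAt-miss : ∀ a as (v : Fin k) vs {f} → a ≢ f → valAt (a ∷ as) (v ∷ vs) f ≡ valAt as vs f
  valAt-miss a as v vs {f} a≢f with a ≡ᵇ f in eq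
  ... | true = ⊥-elim (a≢f (≡ᵇ⇒≡ a f (subst T (sym eq) tt)))
  ... | false = refl

  valAt-defined : ∀ as (vs : List (Fin k)) {f} → f ∈ as → length vs ≡ length as →
    ∃ λ v → valAt as vs f ≡ just v
  valAt-defined (a ∷ as) (v ∷ vs) {f} m l with a ≟ f
  ... | yes refl = v , valAt-hit a as v vs
  ... | no a≢f with m
  ...   | here refl = ⊥-elim (a≢f refl)
  ...   | there m' rewrite valAt-miss a as v vs a≢f = valAt-defined as vs m' (suc-injective l)

  eqAt-true : ∀ (m : Maybe (Fin k)) δ → eqAt m δ ≡ true → m ≡ just δ
  eqAt-true (just v) δ e with v ≟ᶠ δ
  ... | yes refl = refl
  eqAt-true (just v) δ () | no _
  eqAt-true nothing δ ()

  eqAt-refl : ∀ (δ : Fin k) → eqAt (just δ) δ ≡ true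
  eqAt-refl δ with δ ≟ᶠ δ
  ... | yes _ = refl
  ... | no δ≢δ = ⊥-elim (δ≢δ refl)

  satisfies-∷ : ∀ as (vs : List (Fin k)) {f δ} w →
    valAt as vs f ≡ just δ → satisfies as vs w ≡ true → satisfies as vs ((f , δ) ∷ w) ≡ true
  satisfies-∷ as vs {δ = δ} w e s rewrite e | eqAt-refl δ = s

  satisfies-∈ : ∀ as (vs : List (Fin k)) w {f δ} → satisfies as vs w ≡ true → (f , δ) ∈ w →
    valAt as vs f ≡ just δ
  satisfies-∈ as vs ((f , δ) ∷ w) s (here refl) = eqAt-true _ δ (proj₁ (∧-true s))
  satisfies-∈ as vs ((f , δ) ∷ w) s (there m) =
    satisfies-∈ as vs w (proj₂ (∧-true {eqAt (valAt as vs f) δ} s)) m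

  satisfies-++ : ∀ as (vs : List (Fin k)) w w' →
    satisfies as vs (w ++ w') ≡ (satisfies as vs w ∧ satisfies as vs w')
  satisfies-++ as vs [] w' = refl
  satisfies-++ as vs ((f , δ) ∷ w) w' rewrite satisfies-++ as vs w w' =
    sym (∧-assoc (eqAt (valAt as vs f) δ) _ _)

  ∈-sub⁻ : ∀ (T : Table k) w {r} → r ∈ rows (sub T w) → r ∈ rows T × satisfies (attrs T) (proj₁ r) w ≡ true
  ∈-sub⁻ T w = ∈-filterᵇ⁻ _

  ∈-sub⁺ : ∀ (T : Table k) w {r} → r ∈ rows T → satisfies (attrs T) (proj₁ r) w ≡ true → r ∈ rows (sub T w)
  ∈-sub⁺ T w = ∈-filterᵇ⁺ (λ r → satisfies (attrs T) (proj₁ r) w)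

  rows-sub-[] : ∀ (T : Table k) → rows (sub T []) ≡ rows T
  rows-sub-[] T = filterᵇ-true (rows T)

  rows-sub-sub : ∀ (T : Table k) w v → rows (sub (sub T w) v) ≡ rows (sub T (w ++ v))
  rows-sub-sub T w v =
    trans (filterᵇ-filterᵇ (sat w) (sat v) (rows T))
          (filterᵇ-cong (λ r → sym (satisfies-++ (attrs T) (proj₁ r) w v)) (rows T))
    where
    sat : Word k → Row k → Bool
    sat u r = satisfies (attrs T) (proj₁ r) u

  WFTable-sub : ∀ (T : Table k) w → WFTable T → WFTable (sub T w)
  WFTable-sub T w (uA , rowsOK , uR) =
    uA , All-filterᵇ _ rowsOK , Unique-map-filterᵇ proj₁ (λ r → satisfies (attrs T) (proj₁ r) w) uR

  row-length : ∀ {T : Table k} → WFTable T → ∀ {r} → r ∈ rows T → length (proj₁ r) ≡ length (attrs T)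
  row-length (_ , rowsOK , _) m = proj₁ (All.lookup rowsOK m)

  InΠ-⊆ : ∀ (T : Table k) {T' d} → (∀ {r} → r ∈ rows T' → r ∈ rows T) → InΠ T d → InΠ T' d
  InΠ-⊆ T T'⊆T π = All.tabulate λ m → All.lookup π (T'⊆T m)

module _ {k : ℕ} where

  eqVals-refl : ∀ (xs : List (Fin k)) → eqVals xs xs ≡ true
  eqVals-refl xs with ≡-dec _≟ᶠ_ xs xs
  ... | yes _ = refl
  ... | no xs≢xs = ⊥-elim (xs≢xs refl)

  eqVals⇒≡ : ∀ (xs ys : List (Fin k)) → T (eqVals xs ys) → xs ≡ ys
  eqVals⇒≡ xs ys t with ≡-dec _≟ᶠ_ xs ys
  ... | yes e = e

  sameValues : Row k → Row k → Bool
  sameValues r s = eqVals (proj₁ r) (proj₁ s)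

  Unique-map-filter : ∀ {P : Row k → Set} (P? : ∀ r → Dec (P r)) {rs} →
    Unique (map proj₁ rs) → Unique (map proj₁ (filter P? rs))
  Unique-map-filter P? u = AllPairs.map⁺ (AllPairs.filter⁺ P? (AllPairs.map⁻ u))

  Unique-deduplicate : ∀ (rs : List (Row k)) → Unique (map proj₁ (deduplicateᵇ sameValues rs))
  Unique-deduplicate [] = []
  Unique-deduplicate (r ∷ rs) = All.tabulate fresh ∷ Unique-map-filter differs (Unique-deduplicate rs)
    where
    differs = ¬? ∘ T? ∘ sameValues r
    fresh : ∀ {vs} → vs ∈ map proj₁ (filter differs (deduplicateᵇ sameValues rs)) → proj₁ r ≢ vs
    fresh m refl with ∈-map⁻ proj₁ m
    ... | s , sm , e = proj₂ (∈-filter⁻ differs {xs = deduplicateᵇ sameValues rs} sm)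
      (subst (λ vs → T (eqVals vs (proj₁ s))) (sym e) (subst T (sym (eqVals-refl (proj₁ s))) tt))

  deduplicate-unique : ∀ (rs : List (Row k)) → Unique (map proj₁ rs) → deduplicateᵇ sameValues rs ≡ rs
  deduplicate-unique [] u = refl
  deduplicate-unique (r ∷ rs) (r∉ ∷ u) rewrite deduplicate-unique rs u =
    cong (r ∷_) (filter-all (¬? ∘ T? ∘ sameValues r) (All.tabulate λ {s} m t →
      All.lookup r∉ (∈-map⁺ proj₁ m) (eqVals⇒≡ (proj₁ r) (proj₁ s) t)))

  ∈-IJ⁻ : ∀ D ν (T : Table k) {r} → r ∈ rows (Jop ν (Iop D T)) →
    ∃ λ r₀ → r₀ ∈ rows T × proj₁ r ≡ keepCols D (proj₁ r₀) × proj₂ r ≡ ν (proj₁ r)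
  ∈-IJ⁻ D ν T m with ∈-map⁻ (λ r → proj₁ r , ν (proj₁ r)) m
  ... | r₁ , r₁m , refl with ∈-map⁻ (λ r → keepCols D (proj₁ r) , proj₂ r)
                               (∈-deduplicate⁻ (T? ∘₂ sameValues) _ r₁m)
  ...   | r₀ , r₀m , refl = r₀ , r₀m , refl , refl

  WFTable-IJ : ∀ (T : Table k) D ν → WFTable T → (∀ v → ν v ≢ []) → WFTable (Jop ν (Iop D T))
  WFTable-IJ T D ν (uA , rowsOK , _) ν≢[] =
    Unique-keepCols D uA ,
    All.tabulate (λ {r} m → let r₀ , r₀m , e₁ , e₂ = ∈-IJ⁻ D ν T m in
      trans (cong length e₁) (length-keepCols D (proj₁ r₀) (attrs T) (proj₁ (All.lookup rowsOK r₀m))) ,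
      subst (_≢ []) (sym e₂) (ν≢[] (proj₁ r))) ,
    subst Unique (sym (map-proj₁-J (deduplicateᵇ sameValues _))) (Unique-deduplicate _)
    where
    map-proj₁-J : ∀ rs → map proj₁ (map (λ r → proj₁ r , ν (proj₁ r)) rs) ≡ map proj₁ rs
    map-proj₁-J [] = refl
    map-proj₁-J (r ∷ rs) = cong (proj₁ r ∷_) (map-proj₁-J rs)

  decisionOf : List (Fin k) → List (Row k) → DecSet
  decisionOf vs [] = 0 ∷ []
  decisionOf vs ((ws , ds) ∷ rs) = if eqVals vs ws then ds else decisionOf vs rs

  decisionOf-nonempty : ∀ vs (rs : List (Row k)) → All ((_≢ []) ∘ proj₂) rs → decisionOf vs rs ≢ []
  decisionOf-nonempty vs [] _ ()
  decisionOf-nonempty vs ((ws , ds) ∷ rs) (ne ∷ nes) with eqVals vs ws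
  ... | true = ne
  ... | false = decisionOf-nonempty vs rs nes

  decisionOf-row : ∀ (rs : List (Row k)) → Unique (map proj₁ rs) → ∀ {r} → r ∈ rs →
    decisionOf (proj₁ r) rs ≡ proj₂ r
  decisionOf-row ((ws , ds) ∷ rs) u (here refl) rewrite eqVals-refl ws = refl
  decisionOf-row ((ws , ds) ∷ rs) (r∉ ∷ u) {r} (there m) with eqVals (proj₁ r) ws in e
  ... | true = ⊥-elim (All.lookup r∉ (∈-map⁺ proj₁ m) (sym (eqVals⇒≡ _ _ (subst T (sym e) tt))))
  ... | false = decisionOf-row rs u m

  -- Deleting no column and restoring each row's own decision set gives T back.
  InClosure-refl : ∀ (T : Table k) → WFTable T → InClosure T T
  InClosure-refl T (uA , rowsOK , uR) =
    D , ν , length-map _ (attrs T) , (λ vs → decisionOf-nonempty vs (rows T) (All.map proj₂ rowsOK)) ,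
    cong₂ mkTable (sym (keepCols-none D (attrs T) (length-map _ (attrs T)) none)) (sym rows-eq)
    where
    D = map (λ _ → false) (attrs T)
    ν = λ vs → decisionOf vs (rows T)
    none : All (_≡ false) D
    none = All-map⁺ (All.tabulate λ _ → refl)
    I J : Row k → Row k
    I r = keepCols D (proj₁ r) , proj₂ r
    J r = proj₁ r , ν (proj₁ r)
    rows-eq : map J (deduplicateᵇ sameValues (map I (rows T))) ≡ rows T
    rows-eq = begin
      map J (deduplicateᵇ sameValues (map I (rows T)))
        ≡⟨ cong (map J ∘ deduplicateᵇ sameValues) (map-id-local (All.map (λ {r} ok →
             cong (_, proj₂ r) (keepCols-none D _ (trans (length-map _ (attrs T)) (sym (proj₁ ok))) none))
             rowsOK)) ⟩
      map J (deduplicateᵇ sameValues (rows T))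
        ≡⟨ cong (map J) (deduplicate-unique (rows T) uR) ⟩
      map J (rows T)
        ≡⟨ map-id-local (All.tabulate λ {r} m → cong (proj₁ r ,_) (decisionOf-row (rows T) uR m)) ⟩
      rows T ∎
      where open ≡-Reasoning

module _ {k : ℕ} where

  Covers : Table k → List (Word k × ℕ) → Set
  Covers T ps = ∀ r → r ∈ rows T → Σ (Word k × ℕ) λ p → (p ∈ ps) × (r ∈ rows (sub T (proj₁ p)))

  Settles : List (Row k) → ℕ → Set
  Settles rs d = rs ≡ [] ⊎ All (λ r → d ∈ proj₂ r) rs

  Correct : Table k → List (Word k × ℕ) → Set
  Correct T ps = ∀ p → p ∈ ps → Settles (rows (sub T (proj₁ p))) (proj₂ p)

  ∈-pathsCs⁻ : ∀ f (cs : List (Fin k × Node k)) {p} → p ∈ pathsCs f cs →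
    Σ (Fin k × Node k) λ c → c ∈ cs × Σ (Word k × ℕ) λ q →
      q ∈ pathsN (proj₂ c) × p ≡ (((f , proj₁ c) ∷ proj₁ q) , proj₂ q)
  ∈-pathsCs⁻ f ((δ , c) ∷ cs) m with ∈-++⁻ (map (λ p → ((f , δ) ∷ proj₁ p) , proj₂ p) (pathsN c)) m
  ... | inj₁ m' = let q , qm , e = ∈-map⁻ _ m' in (δ , c) , here refl , q , qm , e
  ... | inj₂ m' = let c' , cm , rest = ∈-pathsCs⁻ f cs m' in c' , there cm , rest

  ∈-pathsCs⁺ : ∀ f (cs : List (Fin k × Node k)) {c q} → c ∈ cs → q ∈ pathsN (proj₂ c) →
    (((f , proj₁ c) ∷ proj₁ q) , proj₂ q) ∈ pathsCs f cs
  ∈-pathsCs⁺ f ((δ , c) ∷ cs) (here refl) qm = ∈-++⁺ˡ (∈-map⁺ (λ p → ((f , δ) ∷ proj₁ p) , proj₂ p) qm)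
  ∈-pathsCs⁺ f ((δ , c) ∷ cs) (there cm) qm =
    ∈-++⁺ʳ (map (λ p → ((f , δ) ∷ proj₁ p) , proj₂ p) (pathsN c)) (∈-pathsCs⁺ f cs cm qm)

  mutual
    attrs-pathsN : ∀ {P : ℕ → Set} {N : Node k} → AttrNode P N → ∀ {p} → p ∈ pathsN N →
      All (P ∘ proj₁) (proj₁ p)
    attrs-pathsN (leafA d) (here refl) = []
    attrs-pathsN (testA f cs pf as) m with ∈-pathsCs⁻ f cs m
    ... | c , cm , q , qm , refl = pf ∷ attrs-pathsCs as cm qm

    attrs-pathsCs : ∀ {P : ℕ → Set} {cs : List (Fin k × Node k)} → All (AttrNode P ∘ proj₂) cs →
      ∀ {c q} → c ∈ cs → q ∈ pathsN (proj₂ c) → All (P ∘ proj₁) (proj₁ q)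
    attrs-pathsCs (a ∷ as) (here refl) qm = attrs-pathsN a qm
    attrs-pathsCs (a ∷ as) (there cm) qm = attrs-pathsCs as cm qm

  attrs-paths : ∀ {P : ℕ → Set} {Γ : Tree k} → All (AttrNode P) Γ → ∀ {p} → p ∈ paths Γ →
    All (P ∘ proj₁) (proj₁ p)
  attrs-paths {Γ = N ∷ Γ} (a ∷ as) m with ∈-++⁻ (pathsN N) m
  ... | inj₁ m' = attrs-pathsN a m'
  ... | inj₂ m' = attrs-paths as m'

  ψtree≤ : ∀ (Γ : Tree k) {B} → (∀ p → p ∈ paths Γ → ψword ψ (proj₁ p) ≤ B) → ψtree ψ Γ ≤ B
  ψtree≤ Γ {B} h = foldr-⊔≤ (map (ψword ψ ∘ proj₁) (paths Γ)) λ m →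
    let p , pm , e = ∈-map⁻ _ m in subst (_≤ B) (sym e) (h p pm)
    where
    foldr-⊔≤ : ∀ xs → (∀ {x} → x ∈ xs → x ≤ B) → foldr _⊔_ 0 xs ≤ B
    foldr-⊔≤ [] h = z≤n
    foldr-⊔≤ (x ∷ xs) h = ⊔-lub (h (here refl)) (foldr-⊔≤ xs (h ∘ there))

  ≤ψtree : ∀ (Γ : Tree k) {p} → p ∈ paths Γ → ψword ψ (proj₁ p) ≤ ψtree ψ Γ
  ≤ψtree Γ pm = ≤-foldr-⊔ (∈-map⁺ (ψword ψ ∘ proj₁) pm)
    where
    ≤-foldr-⊔ : ∀ {xs x} → x ∈ xs → x ≤ foldr _⊔_ 0 xs
    ≤-foldr-⊔ {y ∷ xs} (here refl) = m≤m⊔n y _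
    ≤-foldr-⊔ {y ∷ xs} (there m) = ≤-trans (≤-foldr-⊔ m) (m≤n⊔m y _)

  length≤ψtree : ∀ (Γ : Tree k) {p} → p ∈ paths Γ → length (proj₁ p) ≤ ψtree ψ Γ
  length≤ψtree Γ {p} pm = begin
    length (proj₁ p)             ≡⟨ length-map proj₁ (proj₁ p) ⟨
    length (map proj₁ (proj₁ p)) ≤⟨ m≤m⊔n _ _ ⟩
    ψword ψ (proj₁ p)            ≤⟨ ≤ψtree Γ pm ⟩
    ψtree ψ Γ                    ∎
    where open ≤-Reasoning

  leaf-isDTree : ∀ (T : Table k) {d} → InΠ T d → IsDTree T (leaf d ∷ [])
  leaf-isDTree T {d} π =
    record { wf = (λ ()) , leafWF d ∷ []
           ; attrsOK = leafA d ∷ []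
           ; covers = λ r rm → ([] , d) , here refl , subst (r ∈_) (sym (rows-sub-[] T)) rm
           ; correct = λ { _ (here refl) → inj₂ (subst (All _) (sym (rows-sub-[] T)) π) } } ,
    refl , leafD d ∷ []

  -- A path that queries an attribute of weight ≥ m costs ≥ m, so a cheaper tree solves T by a leaf.
  common-decision-of-cheap-tree : ∀ (T : Table k) {m Γ} → rows T ≢ [] →
    All (λ a → m ≤ weight a) (attrs T) → IsNDTree T Γ → ψtree ψ Γ < m → ∃ (InΠ T)
  common-decision-of-cheap-tree T {m} {Γ} ne heavy nd cheap with ∃-∈-nonempty ne
  ... | r , rm with IsNDTree.covers nd r rm
  ...   | p , pm , rin with proj₁ p in eqp | attrs-paths (IsNDTree.attrsOK nd) pm
  ...     | (f , δ) ∷ w | f∈ ∷ _ = ⊥-elim (<⇒≱ cheap (begin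
    m                           ≤⟨ All.lookup heavy f∈ ⟩
    weight f                    ≤⟨ weight≤maxWeight {α = f ∷ map proj₁ w} (here refl) ⟩
    maxWeight (f ∷ map proj₁ w) ≤⟨ m≤n⊔m (length (f ∷ map proj₁ w)) _ ⟩
    ψ (f ∷ map proj₁ w)         ≡⟨ cong (ψword ψ) eqp ⟨
    ψword ψ (proj₁ p)           ≤⟨ ≤ψtree Γ pm ⟩
    ψtree ψ Γ                   ∎))
    where open ≤-Reasoning
  ...     | [] | _ with IsNDTree.correct nd p pm
  ...       | inj₁ e = ⊥-elim (ne (trans (trans (sym (rows-sub-[] T)) (cong (rows ∘ sub T) (sym eqp))) e))
  ...       | inj₂ π = proj₂ p , subst (All _) (trans (cong (rows ∘ sub T) eqp) (rows-sub-[] T)) π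

  firstDecision : List (Row k) → ℕ
  firstDecision [] = 0
  firstDecision ((vs , []) ∷ _) = 0
  firstDecision ((vs , d ∷ ds) ∷ _) = d

  firstDecision-common : ∀ {S : Table k} → WFTable S → length (rows S) ≤ 1 → InΠ S (firstDecision (rows S))
  firstDecision-common {mkTable as []} wf _ = []
  firstDecision-common {mkTable as ((vs , []) ∷ [])} (_ , (_ , ne) ∷ [] , _) _ = ⊥-elim (ne refl)
  firstDecision-common {mkTable as ((vs , d ∷ ds) ∷ [])} wf _ = here refl ∷ []
  firstDecision-common {mkTable as (_ ∷ _ ∷ _)} wf (s≤s ())

  IsPsiA-intro : ∀ {T : Table k} {Γ h} → rows T ≢ [] → IsNDTree T Γ → ψtree ψ Γ ≤ h →
    (∀ Γ' → IsNDTree T Γ' → h ≤ ψtree ψ Γ') → IsPsiA ψ T h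
  IsPsiA-intro {Γ = Γ} ne nd up low = ⊥-elim ∘ ne , λ _ → (Γ , nd , ≤-antisym up (low Γ nd)) , low

  IsPsiD-intro : ∀ {T : Table k} {Γ h} → rows T ≢ [] → IsDTree T Γ → ψtree ψ Γ ≤ h →
    (∀ Γ' → IsDTree T Γ' → h ≤ ψtree ψ Γ') → IsPsiD ψ T h
  IsPsiD-intro {Γ = Γ} ne dt up low = ⊥-elim ∘ ne , λ _ → (Γ , dt , ≤-antisym up (low Γ dt)) , low

module ZeroOne (k' : ℕ) where

  K : ℕ
  K = suc (suc k')

  0F 1F : Fin K
  0F = zero
  1F = suc zero

  AllZero : List (Fin K) → Set
  AllZero = All (_≡ 0F)

  data ZeroUnit : List (Fin K) → Set where
    zu[] : ZeroUnit []
    zu0  : ∀ {vs} → ZeroUnit vs → ZeroUnit (0F ∷ vs)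
    zu1  : ∀ {vs} → AllZero vs → ZeroUnit (1F ∷ vs)

  ZeroUnitRows : Table K → Set
  ZeroUnitRows T = All (ZeroUnit ∘ proj₁) (rows T)

  AllZero⇒ZeroUnit : ∀ {vs} → AllZero vs → ZeroUnit vs
  AllZero⇒ZeroUnit [] = zu[]
  AllZero⇒ZeroUnit (refl ∷ z) = zu0 (AllZero⇒ZeroUnit z)

  ZeroUnit-keepCols : ∀ D {vs} → ZeroUnit vs → ZeroUnit (keepCols D vs)
  ZeroUnit-keepCols (true ∷ D) (zu0 z) = ZeroUnit-keepCols D z
  ZeroUnit-keepCols (true ∷ D) (zu1 a) = AllZero⇒ZeroUnit (All-keepCols D a)
  ZeroUnit-keepCols (false ∷ D) (zu0 z) = zu0 (ZeroUnit-keepCols D z)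
  ZeroUnit-keepCols (false ∷ D) (zu1 a) = zu1 (All-keepCols D a)
  ZeroUnit-keepCols [] z = zu[]
  ZeroUnit-keepCols (true ∷ D) zu[] = zu[]
  ZeroUnit-keepCols (false ∷ D) zu[] = zu[]

  AllZero-≡ : ∀ {vs vs'} → AllZero vs → AllZero vs' → length vs ≡ length vs' → vs ≡ vs'
  AllZero-≡ [] [] _ = refl
  AllZero-≡ (refl ∷ z) (refl ∷ z') l = cong (0F ∷_) (AllZero-≡ z z' (suc-injective l))

  valAt-AllZero : ∀ as {vs f} → AllZero vs → valAt as vs f ≡ nothing ⊎ valAt as vs f ≡ just 0F
  valAt-AllZero [] z = inj₁ refl
  valAt-AllZero (a ∷ as) {[]} z = inj₁ refl
  valAt-AllZero (a ∷ as) {v ∷ vs} {f} (refl ∷ z) with a ≡ᵇ f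
  ... | true = inj₂ refl
  ... | false = valAt-AllZero as z

  valAt-AllZero-≢1 : ∀ as {vs f} → AllZero vs → valAt as vs f ≢ just 1F
  valAt-AllZero-≢1 as z e with valAt-AllZero as z
  ... | inj₁ e' with trans (sym e) e'
  ...   | ()
  valAt-AllZero-≢1 as z e | inj₂ e' with trans (sym e) e'
  ...   | ()

  valAt-ZeroUnit : ∀ as {vs f} → ZeroUnit vs →
    valAt as vs f ≡ nothing ⊎ valAt as vs f ≡ just 0F ⊎ valAt as vs f ≡ just 1F
  valAt-ZeroUnit [] z = inj₁ refl
  valAt-ZeroUnit (a ∷ as) {[]} z = inj₁ refl
  valAt-ZeroUnit (a ∷ as) {v ∷ vs} {f} z with a ≡ᵇ f
  valAt-ZeroUnit (a ∷ as) (zu0 z) | true = inj₂ (inj₁ refl)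
  valAt-ZeroUnit (a ∷ as) (zu1 z) | true = inj₂ (inj₂ refl)
  valAt-ZeroUnit (a ∷ as) (zu0 z) | false = valAt-ZeroUnit as z
  valAt-ZeroUnit (a ∷ as) (zu1 z) | false with valAt-AllZero as z
  ... | inj₁ e = inj₁ e
  ... | inj₂ e = inj₂ (inj₁ e)

  valAt-ZeroUnit-defined : ∀ as {vs f} → f ∈ as → length vs ≡ length as → ZeroUnit vs →
    valAt as vs f ≡ just 0F ⊎ valAt as vs f ≡ just 1F
  valAt-ZeroUnit-defined as f∈ l z with valAt-ZeroUnit as z | valAt-defined as _ f∈ l
  ... | inj₂ e | _ = e
  ... | inj₁ e | v , e' with trans (sym e) e'
  ...   | ()

  ZeroUnit-≡ : ∀ as {vs vs' f} → length vs ≡ length as → length vs' ≡ length as →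
    ZeroUnit vs → ZeroUnit vs' → valAt as vs f ≡ just 1F → valAt as vs' f ≡ just 1F → vs ≡ vs'
  ZeroUnit-≡ [] {[]} {[]} _ _ _ _ _ _ = refl
  ZeroUnit-≡ (a ∷ as) {v ∷ vs} {v' ∷ vs'} {f} l l' z z' e e' with a ≟ f
  ZeroUnit-≡ (a ∷ as) l l' (zu1 z) (zu1 z') e e' | yes refl =
    cong (1F ∷_) (AllZero-≡ z z' (trans (suc-injective l) (sym (suc-injective l'))))
  ZeroUnit-≡ (a ∷ as) {v ∷ vs} l l' (zu0 z) z' e e' | yes refl with trans (sym e) (valAt-hit a as v vs)
  ... | ()
  ZeroUnit-≡ (a ∷ as) {vs' = v' ∷ vs'} l l' (zu1 z) (zu0 z') e e' | yes refl
    with trans (sym e') (valAt-hit a as v' vs')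
  ... | ()
  ZeroUnit-≡ (a ∷ as) {v ∷ vs} {v' ∷ vs'} l l' z z' e e' | no a≢f
    rewrite valAt-miss a as v vs a≢f | valAt-miss a as v' vs' a≢f with z | z'
  ... | zu1 w | _ = ⊥-elim (valAt-AllZero-≢1 as w e)
  ... | zu0 w | zu1 w' = ⊥-elim (valAt-AllZero-≢1 as w' e')
  ... | zu0 w | zu0 w' = cong (0F ∷_) (ZeroUnit-≡ as (suc-injective l) (suc-injective l') w w' e e')

  AllZero-if-valAt-0 : ∀ as {vs} → Unique as → length vs ≡ length as →
    (∀ {a} → a ∈ as → valAt as vs a ≡ just 0F) → AllZero vs
  AllZero-if-valAt-0 [] {[]} u l h = []
  AllZero-if-valAt-0 (a ∷ as) {v ∷ vs} (a∉ ∷ u) l h with trans (sym (valAt-hit a as v vs)) (h (here refl))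
  ... | refl = refl ∷ AllZero-if-valAt-0 as u (suc-injective l)
                 (λ m → trans (sym (valAt-miss a as v vs (All.lookup a∉ m))) (h (there m)))

  ZeroUnit-has-1 : ∀ as {vs} → Unique as → length vs ≡ length as → ZeroUnit vs → ¬ AllZero vs →
    ∃ λ a → a ∈ as × valAt as vs a ≡ just 1F
  ZeroUnit-has-1 [] {[]} u l z nz = ⊥-elim (nz [])
  ZeroUnit-has-1 (a ∷ as) {v ∷ vs} u l (zu1 w) nz = a , here refl , valAt-hit a as v vs
  ZeroUnit-has-1 (a ∷ as) {v ∷ vs} (a∉ ∷ u) l (zu0 w) nz
    with ZeroUnit-has-1 as u (suc-injective l) w (λ z → nz (refl ∷ z))
  ... | b , m , e = b , there m , trans (valAt-miss a as v vs (All.lookup a∉ m)) e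

  ZeroUnitRows-sub : ∀ (T : Table K) w → ZeroUnitRows T → ZeroUnitRows (sub T w)
  ZeroUnitRows-sub T w = All-filterᵇ (λ r → satisfies (attrs T) (proj₁ r) w)

  at-most-one-row : ∀ {T : Table K} → WFTable T →
    (∀ {r r'} → r ∈ rows T → r' ∈ rows T → proj₁ r ≡ proj₁ r') → length (rows T) ≤ 1
  at-most-one-row (_ , _ , uR) = length≤1-if-image-constant proj₁ uR

  at-most-one-row-with-1 : ∀ {T : Table K} → WFTable T → ZeroUnitRows T → ∀ f →
    length (rows (sub T ((f , 1F) ∷ []))) ≤ 1
  at-most-one-row-with-1 {T} wf z f = at-most-one-row (WFTable-sub T ((f , 1F) ∷ []) wf) λ m m' →
    let rm , s = ∈-sub⁻ T ((f , 1F) ∷ []) m ; rm' , s' = ∈-sub⁻ T ((f , 1F) ∷ []) m' in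
    ZeroUnit-≡ (attrs T) (row-length wf rm) (row-length wf rm') (All.lookup z rm) (All.lookup z rm')
      (satisfies-∈ (attrs T) _ ((f , 1F) ∷ []) s (here refl))
      (satisfies-∈ (attrs T) _ ((f , 1F) ∷ []) s' (here refl))

  zeroWord : List ℕ → Word K
  zeroWord = map (_, 0F)

  -- Query the attributes of L in turn; the first answer 1 identifies the row.
  mutual
    chain : (ℕ → ℕ) → List ℕ → ℕ → Node K
    chain dec [] d = leaf d
    chain dec (x ∷ L) d = test x (chainBranches dec x L d)

    chainBranches : (ℕ → ℕ) → ℕ → List ℕ → ℕ → List (Fin K × Node K)
    chainBranches dec x L d = (1F , leaf (dec x)) ∷ (0F , chain dec L d) ∷ []

  chain-paths : ∀ dec L d {p} → p ∈ pathsN (chain dec L d) →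
    (∃ λ x → (x , 1F) ∈ proj₁ p × proj₂ p ≡ dec x) ⊎ p ≡ (zeroWord L , d)
  chain-paths dec [] d (here refl) = inj₂ refl
  chain-paths dec (x ∷ L) d m with ∈-pathsCs⁻ x (chainBranches dec x L d) m
  ... | _ , here refl , q , here refl , refl = inj₁ (x , here refl , refl)
  ... | _ , there (here refl) , q , qm , refl with chain-paths dec L d qm
  ...   | inj₁ (y , ym , e) = inj₁ (y , there ym , e)
  ...   | inj₂ refl = inj₂ refl

  chain-path-length : ∀ dec L d {p} → p ∈ pathsN (chain dec L d) →
    All ((_∈ L) ∘ proj₁) (proj₁ p) × length (proj₁ p) ≤ length L
  chain-path-length dec [] d (here refl) = [] , z≤n
  chain-path-length dec (x ∷ L) d m with ∈-pathsCs⁻ x (chainBranches dec x L d) m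
  ... | _ , here refl , q , here refl , refl = here refl ∷ [] , s≤s z≤n
  ... | _ , there (here refl) , q , qm , refl with chain-path-length dec L d qm
  ...   | a , l = here refl ∷ All.map there a , s≤s l

  chain-covers : ∀ dec L d as {vs} → (∀ {x} → x ∈ L → x ∈ as) → length vs ≡ length as → ZeroUnit vs →
    ∃ λ p → p ∈ pathsN (chain dec L d) × satisfies as vs (proj₁ p) ≡ true
  chain-covers dec [] d as L⊆ l z = ([] , d) , here refl , refl
  chain-covers dec (x ∷ L) d as L⊆ l z with valAt-ZeroUnit-defined as (L⊆ (here refl)) l z
  ... | inj₂ e = ((x , 1F) ∷ [] , dec x) , here refl , satisfies-∷ as _ [] e refl
  ... | inj₁ e with chain-covers dec L d as (L⊆ ∘ there) l z
  ...   | q , qm , s = ((x , 0F) ∷ proj₁ q , proj₂ q) ,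
    ∈-pathsCs⁺ x (chainBranches dec x L d) (there (here refl)) qm , satisfies-∷ as _ (proj₁ q) e s

  chain-deterministic : ∀ dec L d → DetNode (chain dec L d)
  chain-deterministic dec [] d = leafD d
  chain-deterministic dec (x ∷ L) d =
    testD x _ (((λ ()) ∷ []) ∷ [] ∷ []) (leafD (dec x) ∷ chain-deterministic dec L d ∷ [])

  chain-wellFormed : ∀ dec L d → WFNode (chain dec L d)
  chain-wellFormed dec [] d = leafWF d
  chain-wellFormed dec (x ∷ L) d = testWF x _ (λ ()) (leafWF (dec x) ∷ chain-wellFormed dec L d ∷ [])

  chain-attrs : ∀ {P : ℕ → Set} dec L d → All P L → AttrNode P (chain dec L d)
  chain-attrs dec [] d _ = leafA d
  chain-attrs dec (x ∷ L) d (px ∷ pL) = testA x _ px (leafA (dec x) ∷ chain-attrs dec L d pL ∷ [])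

  chain-ψ : ∀ dec L d {B} → length L ≤ B → All (λ a → weight a ≤ B) L → ψtree ψ (chain dec L d ∷ []) ≤ B
  chain-ψ dec L d {B} lL wL = ψtree≤ (chain dec L d ∷ []) bound
    where
    bound : ∀ p → p ∈ paths (chain dec L d ∷ []) → ψword ψ (proj₁ p) ≤ B
    bound p pm with ∈-++⁻ (pathsN (chain dec L d)) pm
    ... | inj₂ ()
    ... | inj₁ pm' with chain-path-length dec L d pm'
    ...   | inL , l = ⊔-lub (≤-trans (≤-reflexive (length-map proj₁ (proj₁ p))) (≤-trans l lL))
                            (maxWeight≤ (All-map⁺ (All.map (All.lookup wL) inL)))

  rowsWith1 : Table K → ℕ → List (Row K)
  rowsWith1 T x = rows (sub T ((x , 1F) ∷ []))

  chainTree : Table K → List ℕ → Node K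
  chainTree T L = chain (firstDecision ∘ rowsWith1 T) L (firstDecision (rows (sub T (zeroWord L))))

  sub-⊆-rowsWith1 : ∀ (T : Table K) {w x r} → (x , 1F) ∈ w → r ∈ rows (sub T w) → r ∈ rowsWith1 T x
  sub-⊆-rowsWith1 T {w} {x} m rm = let rT , s = ∈-sub⁻ T w rm in
    ∈-sub⁺ T ((x , 1F) ∷ []) rT (satisfies-∷ (attrs T) _ [] (satisfies-∈ (attrs T) _ w s m) refl)

  decision-after-1 : ∀ (T : Table K) → WFTable T → ZeroUnitRows T → ∀ w {x} → (x , 1F) ∈ w →
    InΠ (sub T w) (firstDecision (rowsWith1 T x))
  decision-after-1 T wf z w {x} m = InΠ-⊆ (sub T ((x , 1F) ∷ [])) {sub T w} (sub-⊆-rowsWith1 T m)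
    (firstDecision-common (WFTable-sub T ((x , 1F) ∷ []) wf) (at-most-one-row-with-1 wf z x))

  chainTree-isDTree : ∀ (T : Table K) L → WFTable T → ZeroUnitRows T → (∀ {x} → x ∈ L → x ∈ attrs T) →
    length (rows (sub T (zeroWord L))) ≤ 1 → IsDTree T (chainTree T L ∷ [])
  chainTree-isDTree T L wf z L⊆ last≤1 =
    record { wf = (λ ()) , chain-wellFormed dec L d ∷ []
           ; attrsOK = chain-attrs dec L d (All.tabulate L⊆) ∷ []
           ; covers = covers
           ; correct = correct } ,
    refl , chain-deterministic dec L d ∷ []
    where
    dec = firstDecision ∘ rowsWith1 T
    d = firstDecision (rows (sub T (zeroWord L)))
    covers : Covers T (paths (chainTree T L ∷ []))
    covers r rm with chain-covers dec L d (attrs T) L⊆ (row-length wf rm) (All.lookup z rm)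
    ... | p , pm , s = p , ∈-++⁺ˡ pm , ∈-sub⁺ T (proj₁ p) rm s
    correct : Correct T (paths (chainTree T L ∷ []))
    correct p pm with ∈-++⁻ (pathsN (chainTree T L)) pm
    ... | inj₂ ()
    ... | inj₁ pm' with chain-paths dec L d pm'
    ...   | inj₂ refl = inj₂ (firstDecision-common (WFTable-sub T (zeroWord L) wf) last≤1)
    ...   | inj₁ (x , xm , e) =
      inj₂ (subst (InΠ (sub T (proj₁ p))) (sym e) (decision-after-1 T wf z (proj₁ p) xm))

  zeroWord-all-rows≤1 : ∀ {T : Table K} → WFTable T → length (rows (sub T (zeroWord (attrs T)))) ≤ 1
  zeroWord-all-rows≤1 {T} wf = at-most-one-row (WFTable-sub T (zeroWord (attrs T)) wf) λ m m' →
    let rm , s = ∈-sub⁻ T (zeroWord (attrs T)) m ; rm' , s' = ∈-sub⁻ T (zeroWord (attrs T)) m' in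
    AllZero-≡ (allZero rm s) (allZero rm' s') (trans (row-length wf rm) (sym (row-length wf rm')))
    where
    allZero : ∀ {r} → r ∈ rows T → satisfies (attrs T) (proj₁ r) (zeroWord (attrs T)) ≡ true →
      AllZero (proj₁ r)
    allZero rm s = AllZero-if-valAt-0 (attrs T) (proj₁ wf) (row-length wf rm)
      λ am → satisfies-∈ (attrs T) _ (zeroWord (attrs T)) s (∈-map⁺ (_, 0F) am)

  valAt-head-1 : ∀ y L {vs} → Unique (y ∷ L) → length vs ≡ suc (length L) → ZeroUnit vs → ¬ AllZero vs →
    satisfies (y ∷ L) vs (zeroWord L) ≡ true → valAt (y ∷ L) vs y ≡ just 1F
  valAt-head-1 y L u l z nz s with ZeroUnit-has-1 (y ∷ L) u l z nz
  ... | _ , here refl , e = e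
  ... | a , there a∈ , e with trans (sym e) (satisfies-∈ (y ∷ L) _ (zeroWord L) s (∈-map⁺ (_, 0F) a∈))
  ...   | ()

  -- Without all-zero rows the first attribute need not be queried: zeros elsewhere force a 1 there.
  zeroWord-tail-rows≤1 : ∀ {T : Table K} → WFTable T → ZeroUnitRows T → All (¬_ ∘ AllZero ∘ proj₁) (rows T) →
    length (rows (sub T (zeroWord (drop 1 (attrs T))))) ≤ 1
  zeroWord-tail-rows≤1 {T@(mkTable [] rs)} wf z nz = at-most-one-row (WFTable-sub T [] wf) λ m m' →
    let rm , _ = ∈-sub⁻ T [] m ; rm' , _ = ∈-sub⁻ T [] m' in
    trans (length-0 (row-length wf rm)) (sym (length-0 (row-length wf rm')))
    where
    length-0 : ∀ {vs : List (Fin K)} → length vs ≡ 0 → vs ≡ []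
    length-0 {[]} _ = refl
  zeroWord-tail-rows≤1 {T@(mkTable (y ∷ L) rs)} wf z nz = at-most-one-row (WFTable-sub T (zeroWord L) wf)
    λ m m' → let rm , s = ∈-sub⁻ T (zeroWord L) m ; rm' , s' = ∈-sub⁻ T (zeroWord L) m' in
    ZeroUnit-≡ (y ∷ L) (row-length wf rm) (row-length wf rm') (All.lookup z rm) (All.lookup z rm')
      (valAt-head-1 y L (proj₁ wf) (row-length wf rm) (All.lookup z rm) (All.lookup nz rm) s)
      (valAt-head-1 y L (proj₁ wf) (row-length wf rm') (All.lookup z rm') (All.lookup nz rm') s')

  star : (ℕ → ℕ) → List ℕ → Tree K
  star dec = map (λ x → test x ((1F , leaf (dec x)) ∷ []))

  ∈-paths-star⁻ : ∀ dec L {p} → p ∈ paths (star dec L) → ∃ λ x → x ∈ L × p ≡ ((x , 1F) ∷ [] , dec x)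
  ∈-paths-star⁻ dec (x ∷ L) m with ∈-++⁻ (pathsN (test x ((1F , leaf (dec x)) ∷ []))) m
  ... | inj₁ (here refl) = x , here refl , refl
  ... | inj₂ m' = let y , ym , e = ∈-paths-star⁻ dec L m' in y , there ym , e

  ∈-paths-star⁺ : ∀ dec L {x} → x ∈ L → ((x , 1F) ∷ [] , dec x) ∈ paths (star dec L)
  ∈-paths-star⁺ dec (x ∷ L) (here refl) = here refl
  ∈-paths-star⁺ dec (y ∷ L) (there m) =
    ∈-++⁺ʳ (pathsN (test y ((1F , leaf (dec y)) ∷ []))) (∈-paths-star⁺ dec L m)

  star-wellFormed : ∀ dec L → L ≢ [] → WFTree (star dec L)
  star-wellFormed dec [] ne = ⊥-elim (ne refl)
  star-wellFormed dec (x ∷ L) _ = (λ ()) , All-map⁺ (All.tabulate λ _ → testWF _ _ (λ ()) (leafWF _ ∷ []))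

  star-attrs : ∀ {P : ℕ → Set} dec {L} → All P L → All (AttrNode P) (star dec L)
  star-attrs dec pL = All-map⁺ (All.map (λ px → testA _ _ px (leafA _ ∷ [])) pL)

  -- Every row has a 1 somewhere, so the queries "is attribute x equal to 1?" cover the table.
  starTree-isNDTree : ∀ (T : Table K) → WFTable T → ZeroUnitRows T → All (¬_ ∘ AllZero ∘ proj₁) (rows T) →
    attrs T ≢ [] → IsNDTree T (star (firstDecision ∘ rowsWith1 T) (attrs T))
  starTree-isNDTree T wf z nz ne = record
    { wf = star-wellFormed dec (attrs T) ne
    ; attrsOK = star-attrs dec (All.tabulate (λ m → m))
    ; covers = covers
    ; correct = correct }
    where
    dec = firstDecision ∘ rowsWith1 T
    covers : Covers T (paths (star dec (attrs T)))
    covers r rm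
      with ZeroUnit-has-1 (attrs T) (proj₁ wf) (row-length wf rm) (All.lookup z rm) (All.lookup nz rm)
    ... | x , xm , e = _ , ∈-paths-star⁺ dec (attrs T) xm ,
      ∈-sub⁺ T ((x , 1F) ∷ []) rm (satisfies-∷ (attrs T) (proj₁ r) [] e refl)
    correct : Correct T (paths (star dec (attrs T)))
    correct p pm with ∈-paths-star⁻ dec (attrs T) pm
    ... | x , _ , refl = inj₂ (decision-after-1 T wf z ((x , 1F) ∷ []) (here refl))

  star-ψ : ∀ dec L {n} → 1 ≤ n → All (λ a → weight a ≡ n) L → ψtree ψ (star dec L) ≤ n
  star-ψ dec L {n} n≥1 wL = ψtree≤ (star dec L) λ p pm → bound (∈-paths-star⁻ dec L pm)
    where
    bound : ∀ {p} → (∃ λ x → x ∈ L × p ≡ ((x , 1F) ∷ [] , dec x)) → ψword ψ (proj₁ p) ≤ n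
    bound (x , xm , refl) = ⊔-lub n≥1 (⊔-lub (≤-reflexive (All.lookup wL xm)) z≤n)

  DisjointDecisions : Table K → Set
  DisjointDecisions T = ∀ {r r' d} → r ∈ rows T → r' ∈ rows T → d ∈ proj₂ r → d ∈ proj₂ r' → r ≡ r'

  valAt-1-if-not-0 : ∀ as {vs f} → f ∈ as → length vs ≡ length as → ZeroUnit vs →
    satisfies as vs ((f , 0F) ∷ []) ≡ false → valAt as vs f ≡ just 1F
  valAt-1-if-not-0 as f∈ l z s with valAt-ZeroUnit-defined as f∈ l z
  ... | inj₂ e = e
  ... | inj₁ e with trans (sym s) (satisfies-∷ as _ [] e refl)
  ...   | ()

  -- At most one row (the one with a 1 there) leaves the 0-branch of a query.
  rows≤1+rows-answering-0 : ∀ {S : Table K} → WFTable S → ZeroUnitRows S → ∀ {f} → f ∈ attrs S →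
    length (rows S) ≤ suc (length (rows (sub S ((f , 0F) ∷ []))))
  rows≤1+rows-answering-0 {S} wf z {f} f∈ = begin
    length (rows S)                                       ≡⟨ length-filterᵇ-partition answers0 (rows S) ⟩
    length (rows (sub S ((f , 0F) ∷ []))) + length others ≤⟨ +-monoʳ-≤ _ others≤1 ⟩
    length (rows (sub S ((f , 0F) ∷ []))) + 1             ≡⟨ +-comm _ 1 ⟩
    suc (length (rows (sub S ((f , 0F) ∷ []))))           ∎
    where
    open ≤-Reasoning
    answers0 : Row K → Bool
    answers0 r = satisfies (attrs S) (proj₁ r) ((f , 0F) ∷ [])
    others = filterᵇ (not ∘ answers0) (rows S)
    answers1 : ∀ {r} → r ∈ others → r ∈ rows S × valAt (attrs S) (proj₁ r) f ≡ just 1F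
    answers1 m = let rm , s = ∈-filterᵇ⁻ (not ∘ answers0) m in
      rm , valAt-1-if-not-0 (attrs S) f∈ (row-length wf rm) (All.lookup z rm)
             (trans (sym (not-involutive _)) (cong not s))
    others≤1 : length others ≤ 1
    others≤1 = length≤1-if-image-constant proj₁ (Unique-map-filterᵇ proj₁ _ (proj₂ (proj₂ wf))) λ m m' →
      let rm , e = answers1 m ; rm' , e' = answers1 m' in
      ZeroUnit-≡ (attrs S) (row-length wf rm) (row-length wf rm') (All.lookup z rm) (All.lookup z rm') e e'

  DisjointDecisions-sub : ∀ (S : Table K) w → DisjointDecisions S → DisjointDecisions (sub S w)
  DisjointDecisions-sub S w disj m m' = disj (proj₁ (∈-sub⁻ S w m)) (proj₁ (∈-sub⁻ S w m'))

  answer-0 : ∀ (S : Table K) f δ q {r} → r ∈ rows (sub S ((f , 0F) ∷ [])) →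
    r ∈ rows (sub S ((f , δ) ∷ q)) → δ ≡ 0F
  answer-0 S f δ q m m' = just-injective (trans
    (sym (satisfies-∈ (attrs S) _ ((f , δ) ∷ q) (proj₂ (∈-sub⁻ S ((f , δ) ∷ q) m')) (here refl)))
    (satisfies-∈ (attrs S) _ ((f , 0F) ∷ []) (proj₂ (∈-sub⁻ S ((f , 0F) ∷ []) m)) (here refl)))

  zero-child-covers : ∀ (S : Table K) {f cs N} → Unique (map proj₁ cs) → (0F , N) ∈ cs →
    Covers S (pathsCs f cs) → Covers (sub S ((f , 0F) ∷ [])) (pathsN N)
  zero-child-covers S {f} {cs} uL cm cov r rm with cov r (proj₁ (∈-sub⁻ S ((f , 0F) ∷ []) rm))
  ... | p , pm , rin with ∈-pathsCs⁻ f cs pm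
  ...   | c , cm' , q , qm , refl
    with Unique-map-injective proj₁ uL cm' cm (answer-0 S f (proj₁ c) (proj₁ q) rm rin)
  ...     | refl = q , qm , subst (r ∈_) (sym (rows-sub-sub S ((f , 0F) ∷ []) (proj₁ q))) rin

  zero-child-correct : ∀ (S : Table K) {f cs N} → (0F , N) ∈ cs →
    Correct S (pathsCs f cs) → Correct (sub S ((f , 0F) ∷ [])) (pathsN N)
  zero-child-correct S {f} {cs} cm cor q qm = subst (λ rs → Settles rs (proj₂ q))
    (sym (rows-sub-sub S ((f , 0F) ∷ []) (proj₁ q))) (cor _ (∈-pathsCs⁺ f cs cm qm))

  LongPath : Node K → Set
  LongPath N = ∀ {S : Table K} → WFTable S → ZeroUnitRows S → DisjointDecisions S →
    AttrNode (_∈ attrs S) N → DetNode N → Covers S (pathsN N) → Correct S (pathsN N) → rows S ≢ [] →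
    ∃ λ p → p ∈ pathsN N × length (rows S) ≤ suc (length (proj₁ p))

  long-path-through-0 : ∀ {f cs} → All (LongPath ∘ proj₂) cs → ∀ {S : Table K} →
    WFTable S → ZeroUnitRows S → DisjointDecisions S →
    All (AttrNode (_∈ attrs S) ∘ proj₂) cs → All (DetNode ∘ proj₂) cs → Unique (map proj₁ cs) →
    Covers S (pathsCs f cs) → Correct S (pathsCs f cs) → ∀ {r₀} → r₀ ∈ rows (sub S ((f , 0F) ∷ [])) →
    ∃ λ p → p ∈ pathsCs f cs × length (rows (sub S ((f , 0F) ∷ []))) ≤ length (proj₁ p)
  long-path-through-0 {f} {cs} ih {S} wf z disj as ds uL cov cor r₀∈
    with cov _ (proj₁ (∈-sub⁻ S ((f , 0F) ∷ []) r₀∈))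
  ... | p , pm , rin with ∈-pathsCs⁻ f cs pm
  ...   | (δ , N) , cm , q , _ , refl with answer-0 S f δ (proj₁ q) r₀∈ rin
  ...     | refl with All.lookup ih cm {sub S ((f , 0F) ∷ [])}
                     (WFTable-sub S ((f , 0F) ∷ []) wf) (ZeroUnitRows-sub S ((f , 0F) ∷ []) z)
                     (DisjointDecisions-sub S ((f , 0F) ∷ []) disj) (All.lookup as cm) (All.lookup ds cm)
                     (zero-child-covers S uL cm cov) (zero-child-correct S cm cor) (≢[]-∈ r₀∈)
  ...       | q* , q*m , bound = ((f , 0F) ∷ proj₁ q* , proj₂ q*) , ∈-pathsCs⁺ f cs cm q*m , bound

  -- The adversary answers 0 to every query; each answer 0 discards at most one row.
  mutual
    long-path : ∀ N → LongPath N
    long-path (leaf d) {S} wf z disj _ _ cov cor ne =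
      ([] , d) , here refl , settled (subst (λ rs → Settles rs d) (rows-sub-[] S) (cor ([] , d) (here refl)))
      where
      settled : Settles (rows S) d → length (rows S) ≤ 1
      settled (inj₁ e) = subst (λ rs → length rs ≤ 1) (sym e) z≤n
      settled (inj₂ π) = at-most-one-row wf λ m m' → cong proj₁ (disj m m' (All.lookup π m) (All.lookup π m'))
    long-path (test f cs) {S} wf z disj (testA _ _ f∈ as) (testD _ _ uL ds) cov cor ne
      with empty-or-∈ (rows (sub S ((f , 0F) ∷ [])))
    ... | inj₁ e₀ = let r , rm = ∃-∈-nonempty ne ; p , pm , _ = cov r rm in
      p , pm , ≤-trans (subst (λ rs → length (rows S) ≤ suc (length rs)) e₀ (rows≤1+rows-answering-0 wf z f∈))
                       (s≤s z≤n)
    ... | inj₂ (r₀ , r₀∈) =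
      let p , pm , bound₀ = long-path-through-0 (long-paths cs) wf z disj as ds uL cov cor r₀∈ in
      p , pm , ≤-trans (rows≤1+rows-answering-0 wf z f∈) (s≤s bound₀)

    long-paths : ∀ cs → All (LongPath ∘ proj₂) cs
    long-paths [] = []
    long-paths ((δ , N) ∷ cs) = long-path N ∷ long-paths cs

  rows≤1+ψtree : ∀ (T : Table K) {Γ} → WFTable T → ZeroUnitRows T → DisjointDecisions T → rows T ≢ [] →
    IsDTree T Γ → length (rows T) ≤ suc (ψtree ψ Γ)
  rows≤1+ψtree T {N ∷ []} wf z disj ne (nd , _ , dN ∷ [])
    with long-path N {T} wf z disj (All.lookup (IsNDTree.attrsOK nd) (here refl)) dN covers correct ne
    where
    covers : Covers T (pathsN N)
    covers r rm with IsNDTree.covers nd r rm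
    ... | p , pm , rin with ∈-++⁻ (pathsN N) pm
    ...   | inj₁ pm' = p , pm' , rin
    ...   | inj₂ ()
    correct : Correct T (pathsN N)
    correct p pm = IsNDTree.correct nd p (∈-++⁺ˡ pm)
  ... | p , pm , bound = ≤-trans bound (s≤s (length≤ψtree (N ∷ []) (∈-++⁺ˡ pm)))

  unitVector : ∀ {m} → Fin m → List (Fin K)
  unitVector {suc m} zero = 1F ∷ replicate m 0F
  unitVector {suc m} (suc i) = 0F ∷ unitVector i

  length-unitVector : ∀ {m} (i : Fin m) → length (unitVector i) ≡ m
  length-unitVector {suc m} zero = cong suc (length-replicate m)
  length-unitVector (suc i) = cong suc (length-unitVector i)

  unitVector-ZeroUnit : ∀ {m} (i : Fin m) → ZeroUnit (unitVector i)
  unitVector-ZeroUnit {suc m} zero = zu1 (replicate-AllZero m)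
    where
    replicate-AllZero : ∀ m → AllZero (replicate m 0F)
    replicate-AllZero zero = []
    replicate-AllZero (suc m) = refl ∷ replicate-AllZero m
  unitVector-ZeroUnit (suc i) = zu0 (unitVector-ZeroUnit i)

  unitVector-nonzero : ∀ {m} (i : Fin m) → ¬ AllZero (unitVector i)
  unitVector-nonzero zero (() ∷ _)
  unitVector-nonzero (suc i) (_ ∷ z) = unitVector-nonzero i z

  unitVector-injective : ∀ {m} {i j : Fin m} → unitVector i ≡ unitVector j → i ≡ j
  unitVector-injective {i = zero} {zero} e = refl
  unitVector-injective {i = suc i} {suc j} e = cong suc (unitVector-injective (cong (drop 1) e))
  unitVector-injective {i = zero} {suc j} ()
  unitVector-injective {i = suc i} {zero} ()

  unitRow : ∀ {s} → Fin s → Row K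
  unitRow i = unitVector i , toℕ i ∷ []

  unitTable : ℕ → ℕ → Table K
  unitTable n s = mkTable (tabulate {n = s} (pair n ∘ toℕ)) (tabulate (unitRow {s}))

  module _ (n s : ℕ) where

    unitTable-wellFormed : WFTable (unitTable n s)
    unitTable-wellFormed =
      Unique-tabulate⁺ (toℕ-injective ∘ pair-injectiveʳ n) ,
      All-tabulate⁺ (λ i → trans (length-unitVector i) (sym (length-tabulate _)) , λ ()) ,
      subst Unique (sym (map-tabulate unitRow proj₁)) (Unique-tabulate⁺ unitVector-injective)

    unitTable-weights : All (λ a → weight a ≡ n) (attrs (unitTable n s))
    unitTable-weights = All-tabulate⁺ (weight-pair n ∘ toℕ)

    unitTable-ZeroUnitRows : ZeroUnitRows (unitTable n s)
    unitTable-ZeroUnitRows = All-tabulate⁺ unitVector-ZeroUnit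

    unitTable-nonzero : All (¬_ ∘ AllZero ∘ proj₁) (rows (unitTable n s))
    unitTable-nonzero = All-tabulate⁺ unitVector-nonzero

    unitTable-disjoint : DisjointDecisions (unitTable n s)
    unitTable-disjoint {d = d} m m' d∈ d∈' with ∈-tabulate⁻ {f = unitRow} m | ∈-tabulate⁻ {f = unitRow} m'
    ... | i , e | j , e' =
      trans e (trans (cong unitRow (toℕ-injective (trans (sym (index e d∈)) (index e' d∈')))) (sym e'))
      where
      index : ∀ {r} {i : Fin s} → r ≡ unitRow i → d ∈ proj₂ r → d ≡ toℕ i
      index refl (here e) = e

  unitTable-noCommonDecision : ∀ n {s d} → 1 ≤ s → ¬ InΠ (unitTable n (suc s)) d
  unitTable-noCommonDecision n (s≤s z≤n) π
    with All-tabulate⁻ {f = unitRow} π zero | All-tabulate⁻ {f = unitRow} π (suc zero)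
  ... | here refl | here ()

  module _ {n s : ℕ} where

    private
      E = unitTable n (suc s)
      wf = unitTable-wellFormed n (suc s)
      z = unitTable-ZeroUnitRows n (suc s)
      nz = unitTable-nonzero n (suc s)
      weights = unitTable-weights n (suc s)

    unitTable-ψᵃ : 1 ≤ n → 1 ≤ s → IsPsiA ψ E n
    unitTable-ψᵃ n≥1 s≥1 = IsPsiA-intro (λ ()) (starTree-isNDTree E wf z nz (λ ()))
      (star-ψ _ (attrs E) n≥1 weights) lower
      where
      lower : ∀ Γ → IsNDTree E Γ → n ≤ ψtree ψ Γ
      lower Γ nd with n ≤? ψtree ψ Γ
      ... | yes n≤ = n≤
      ... | no n≰ = let d , π = common-decision-of-cheap-tree E (λ ())
                                  (All.map (≤-reflexive ∘ sym) weights) nd (≰⇒> n≰) in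
                    ⊥-elim (unitTable-noCommonDecision n s≥1 π)

    -- Query every attribute but the first; the adversary forces s queries.
    unitTable-ψᵈ : n ≤ s → IsPsiD ψ E s
    unitTable-ψᵈ n≤s = IsPsiD-intro (λ ())
      (chainTree-isDTree E tail wf z there (zeroWord-tail-rows≤1 wf z nz))
      (chain-ψ _ tail _ (≤-reflexive (suc-injective (length-tabulate {n = suc s} (pair n ∘ toℕ))))
        (All.tabulate (λ a∈ → ≤-trans (≤-reflexive (All.lookup weights (there a∈))) n≤s)))
      λ Γ dt → ≤-pred (subst (_≤ suc (ψtree ψ Γ)) (length-tabulate (unitRow {suc s}))
                         (rows≤1+ψtree E wf z (unitTable-disjoint n _) (λ ()) dt))
      where
      tail = drop 1 (attrs E)

module Construction (k' : ℕ) (φ : ℕ → ℕ) (φ-mono : ∀ m n → m ≤ n → φ m ≤ φ n) (φ-≥ : ∀ n → n ≤ φ n)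
                    (φ-0 : φ 0 ≡ 0) where

  open ZeroOne k'

  record InClass (T : Table K) : Set where
    field
      level           : ℕ
      wellFormed      : WFTable T
      weights         : All (λ a → weight a ≡ level) (attrs T)
      width           : length (attrs T) ≤ suc (φ level)
      zeroUnit        : ZeroUnitRows T
      narrowOrNonzero : length (attrs T) ≤ φ level ⊎ All (¬_ ∘ AllZero ∘ proj₁) (rows T)

  open InClass

  InClass-closed : ∀ T T' → InClass T → InClosure T T' → InClass T'
  InClass-closed T _ c (D , ν , lD , ν≢[] , refl) = record
    { level = level c
    ; wellFormed = WFTable-IJ T D ν (wellFormed c) ν≢[]
    ; weights = All-keepCols D (weights c)
    ; width = ≤-trans (length-keepCols≤ D (attrs T)) (width c)
    ; zeroUnit = All.tabulate λ m → let r₀ , r₀m , e , _ = ∈-IJ⁻ D ν T m in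
        subst ZeroUnit (sym e) (ZeroUnit-keepCols D (All.lookup (zeroUnit c) r₀m))
    ; narrowOrNonzero = narrowOrNonzero' (deletes-some-or-none D) }
    where
    narrowOrNonzero' : true ∈ D ⊎ All (_≡ false) D →
      length (keepCols D (attrs T)) ≤ φ (level c) ⊎ All (¬_ ∘ AllZero ∘ proj₁) (rows (Jop ν (Iop D T)))
    narrowOrNonzero' (inj₁ t) = inj₁ (≤-pred (≤-trans (length-keepCols< D (attrs T) lD t) (width c)))
    narrowOrNonzero' (inj₂ none) with narrowOrNonzero c
    ... | inj₁ l = inj₁ (subst (λ as → length as ≤ φ (level c)) (sym (keepCols-none D (attrs T) lD none)) l)
    ... | inj₂ nz = inj₂ (All.tabulate λ m → let r₀ , r₀m , e , _ = ∈-IJ⁻ D ν T m in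
      subst (¬_ ∘ AllZero) (sym (trans e (keepCols-none D _
        (trans lD (sym (row-length (wellFormed c) r₀m))) none))) (All.lookup nz r₀m))

  InClass-closedClass : ClosedClass K InClass
  InClass-closedClass = (λ _ → wellFormed) , InClass-closed , λ T c → T , c , InClosure-refl T (wellFormed c)

  dTree-of-level : ∀ {T} (c : InClass T) → ∃ λ Γ → IsDTree T Γ × ψtree ψ Γ ≤ φ (level c)
  dTree-of-level {T} c with narrowOrNonzero c
  ... | inj₁ narrow =
    _ , chainTree-isDTree T (attrs T) (wellFormed c) (zeroUnit c) (λ m → m)
          (zeroWord-all-rows≤1 (wellFormed c)) ,
    chain-ψ _ (attrs T) _ narrow (All.map (λ e → ≤-trans (≤-reflexive e) (φ-≥ _)) (weights c))
  ... | inj₂ nz =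
    _ , chainTree-isDTree T (drop 1 (attrs T)) (wellFormed c) (zeroUnit c) drop-1-⊆
          (zeroWord-tail-rows≤1 (wellFormed c) (zeroUnit c) nz) ,
    chain-ψ _ (drop 1 (attrs T)) _ (length-drop-1 (attrs T) (width c))
      (All.tabulate λ m → ≤-trans (≤-reflexive (All.lookup (weights c) (drop-1-⊆ m))) (φ-≥ _))
    where
    drop-1-⊆ : ∀ {xs : List ℕ} {x} → x ∈ drop 1 xs → x ∈ xs
    drop-1-⊆ {_ ∷ _} = there
    length-drop-1 : ∀ (xs : List ℕ) {n} → length xs ≤ suc n → length (drop 1 xs) ≤ n
    length-drop-1 [] _ = z≤n
    length-drop-1 (_ ∷ xs) (s≤s l) = l

  ψᵈ≤φ : ∀ n {T a d} → InClass T → IsPsiA ψ T a → a ≤ n → IsPsiD ψ T d → d ≤ φ n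
  ψᵈ≤φ n {T} c ψᵃ a≤n ψᵈ with empty-or-∈ (rows T)
  ... | inj₁ e = ≤-trans (≤-reflexive (proj₁ ψᵈ e)) z≤n
  ... | inj₂ (_ , rm) with level c ≤? n
  ...   | yes l≤n = let Γ , dt , cost = dTree-of-level c in
                    ≤-trans (proj₂ (proj₂ ψᵈ (≢[]-∈ rm)) Γ dt) (≤-trans cost (φ-mono _ _ l≤n))
  ...   | no l≰n with proj₁ (proj₂ ψᵃ (≢[]-∈ rm))
  ...     | Γ , nd , refl with common-decision-of-cheap-tree T (≢[]-∈ rm)
                                (All.map (≤-reflexive ∘ sym) (weights c)) nd (≤-<-trans a≤n (≰⇒> l≰n))
  ...       | d₀ , π = ≤-trans (proj₂ (proj₂ ψᵈ (≢[]-∈ rm)) _ (leaf-isDTree T π)) z≤n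

  unitTable-InClass : ∀ n → InClass (unitTable n (suc (φ n)))
  unitTable-InClass n = record
    { level = n
    ; wellFormed = unitTable-wellFormed n _
    ; weights = unitTable-weights n _
    ; width = ≤-reflexive (length-tabulate {n = suc (φ n)} (pair n ∘ toℕ))
    ; zeroUnit = unitTable-ZeroUnitRows n _
    ; narrowOrNonzero = inj₂ (unitTable-nonzero n _) }

  emptyTable-InClass : InClass (mkTable [] [])
  emptyTable-InClass = record
    { level = 0 ; wellFormed = [] , [] , [] ; weights = [] ; width = z≤n ; zeroUnit = []
    ; narrowOrNonzero = inj₁ z≤n }

  H-is-φ : ∀ n → HIs ψ InClass n (φ n)
  H-is-φ zero =
    (mkTable [] [] , emptyTable-InClass , 0 , ((λ _ → refl) , λ ne → ⊥-elim (ne refl)) , z≤n ,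
      ((λ _ → φ-0) , λ ne → ⊥-elim (ne refl))) ,
    λ _ _ _ → ψᵈ≤φ 0
  H-is-φ n@(suc _) =
    (unitTable n (suc (φ n)) , unitTable-InClass n , n ,
      unitTable-ψᵃ (s≤s z≤n) φn≥1 , ≤-refl , unitTable-ψᵈ (φ-≥ n)) ,
    λ _ _ _ → ψᵈ≤φ n
    where
    φn≥1 : 1 ≤ φ n
    φn≥1 = ≤-trans (s≤s z≤n) (φ-≥ n)

  InClass-nontrivial : Nontrivial InClass
  InClass-nontrivial = unitTable 1 (suc (φ 1)) , unitTable-InClass 1 , λ ()

theorem3 : (k : ℕ) → 2 ≤ k → (φ : ℕ → ℕ) →
    (∀ m n → m ≤ n → φ m ≤ φ n) → (∀ n → n ≤ φ n) → φ 0 ≡ 0 →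
    Σ (Table k → Set) λ A → Σ (List ℕ → ℕ) λ ψ →
    ClosedClass k A × Nontrivial A × BoundedMeasure ψ ×
    (∀ n → Σ ℕ λ h → HIs ψ A n h × (φ n ≤ h) × (h ≤ φ n + n))
theorem3 (suc (suc k')) (s≤s (s≤s z≤n)) φ φ-mono φ-≥ φ-0 =
  InClass , ψ , InClass-closedClass , InClass-nontrivial , ψ-bounded ,
  λ n → φ n , H-is-φ n , ≤-refl , m≤m+n (φ n) n
  where open Construction k' φ φ-mono φ-≥ φ-0
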